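{- Let $k\ge 1$ and $n\ge 0$ be integers, and let $a_1,\ldots,a_k$ be non-negative integers with $a_1+\cdots+a_k=n$. Then $\big|\mathcal{K}_{k,k-1}^{n}(a_1,\ldots,a_k)\big|$ is symmetric in $a_1,\ldots,a_k$: for every permutation $\sigma$ of $\{1,\ldots,k\}$, \[ \big|\mathcal{K}_{k,k-1}^{n}(a_1,\ldots,a_k)\big| = \big|\mathcal{K}_{k,k-1}^{n}(a_{\sigma(1)},\ldots,a_{\sigma(k)})\big|. \]
   Context: For non-negative integers $k,t,n$ with $0\le t<k$, a $k_t$-Dyck path of length $(k+1)n$ is a lattice path consisting of $n$ down-steps $(1,-k)$ and $kn$ up-steps $(1,1)$ that starts at $(0,0)$, ends at $((k+1)n,0)$, and stays weakly above the line $y=-t$. For non-negative integers $a_1,\ldots,a_k$ with $a_1+\cdots+a_k=n$, $\mathcal{K}_{k,t}^{n}(a_1,\ldots,a_k)$ denotes the set of $k_t$-Dyck paths of length $(k+1)n$ having, for each $1\le i\le k$, exactly $a_i$ down-steps whose endpoints are at a height congruent to $i$ modulo $k$. -}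

module Defs where

open import Data.Nat using (ℕ; zero; suc; _+_; _*_; _%_; NonZero)
open import Data.Integer as ℤ using (ℤ; +_; -[1+_]; _%ℕ_)
open import Data.Fin using (Fin; toℕ)
open import Data.List using (List; []; _∷_; length; filter; map; concatMap; tabulate)
open import Data.Nat.ListAction using (sum)
open import Relation.Nullary using (Dec; yes; no)
open import Relation.Nullary.Decidable using (_×-dec_)
import Data.Fin.Properties
import Data.List.Relation.Unary.All
open import Relation.Unary using (Pred; Decidable)
open import Relation.Binary.PropositionalEquality using (_≡_)
open import Data.Product using (_×_)
open import Data.List.Relation.Unary.All using (All)

-- A step of a lattice path: up-step (1,1) or down-step (1,-k).
data Step : Set where
  U D : Step

words : ℕ → List (List Step)
words zero    = [] ∷ []
words (suc m) = concatMap (λ w → (U ∷ w) ∷ (D ∷ w) ∷ []) (words m)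

heights : ℕ → ℤ → List Step → List ℤ
heights k h []       = []
heights k h (U ∷ w)  = (h ℤ.+ + 1) ∷ heights k (h ℤ.+ + 1) w
heights k h (D ∷ w)  = (h ℤ.- + k) ∷ heights k (h ℤ.- + k) w

endHeight : ℕ → ℤ → List Step → ℤ
endHeight k h []      = h
endHeight k h (U ∷ w) = endHeight k (h ℤ.+ + 1) w
endHeight k h (D ∷ w) = endHeight k (h ℤ.- + k) w

downEnds : ℕ → ℤ → List Step → List ℤ
downEnds k h []      = []
downEnds k h (U ∷ w) = downEnds k (h ℤ.+ + 1) w
downEnds k h (D ∷ w) = (h ℤ.- + k) ∷ downEnds k (h ℤ.- + k) w

numD : List Step → ℕ
numD []      = 0
numD (U ∷ w) = numD w
numD (D ∷ w) = suc (numD w)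

countMod : (m : ℕ) .{{_ : NonZero m}} → ℕ → List ℤ → ℕ
countMod m r []      = 0
countMod m r (x ∷ l) with (x %ℕ m) Data.Nat.≟ (r % m)
... | yes _ = suc (countMod m r l)
... | no  _ = countMod m r l

-- k_t-Dyck path of length (k+1)n (here the step count is (k+1)n by
-- construction of the enumeration): n down-steps, ends at height 0,
-- and all visited heights are ≥ -t.
IsKtDyck : (k t n : ℕ) → List Step → Set
IsKtDyck k t n w =
  (numD w ≡ n) × (endHeight k (+ 0) w ≡ + 0) × All (λ y → ℤ.- (+ t) ℤ.≤ y) (heights k (+ 0) w)

-- Membership in K^n_{k,t}(a_1,…,a_k); here k = suc m and a : Fin k → ℕ,
-- with a i (i : Fin k, 0-based) playing the role of a_{toℕ i + 1}:
-- exactly a i down-steps end at a height ≡ toℕ i + 1 (mod k).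
InK : (m t n : ℕ) (a : Fin (suc m) → ℕ) → List Step → Set
InK m t n a w =
  IsKtDyck (suc m) t n w ×
  ((i : Fin (suc m)) → countMod (suc m) (suc (toℕ i)) (downEnds (suc m) (+ 0) w) ≡ a i)

inK? : (m t n : ℕ) (a : Fin (suc m) → ℕ) → Decidable (InK m t n a)
inK? m t n a w =
  ((numD w Data.Nat.≟ n) ×-dec (endHeight (suc m) (+ 0) w ℤ.≟ + 0) ×-dec
    Data.List.Relation.Unary.All.all? (λ y → ℤ.- (+ t) ℤ.≤? y) (heights (suc m) (+ 0) w))
  ×-dec Data.Fin.Properties.all? (λ i → countMod (suc m) (suc (toℕ i)) (downEnds (suc m) (+ 0) w) Data.Nat.≟ a i)

cardK : (m t n : ℕ) (a : Fin (suc m) → ℕ) → ℕ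
cardK m t n a = length (filter (inK? m t n a) (words ((suc m + 1) * n)))

sumFin : {k : ℕ} → (Fin k → ℕ) → ℕ
sumFin a = sum (tabulate a)

module Submission where

-- A path of K^n_{k,k-1} starts at height 0 and may not go below 1 - k, so its first step is
-- an up-step and it reads U D^c₁ U D^c₂ ⋯ U D^c_{kn}. A down-step of the j-th block ends at
-- height j - k·(number of down-steps so far) ≡ j (mod k), hence a_i is the sum of the c_j
-- with j ≡ i (mod k). Cut (c₁, …, c_{kn}) into n windows of k consecutive entries. If the
-- height shifted by k - 1 is T·k - 1 when a window starts, the window stays above the floor
-- iff its sum s is at most T, and it ends at shifted height (T - s + 1)·k - 1. So the floor
-- condition only sees window sums, and permuting the entries of every window by σ maps
-- K(a₁, …, a_k) bijectively onto K(a_σ(1), …, a_σ(k)).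

open import Defs
open import Data.Nat as ℕ using (ℕ; zero; suc; _+_; _*_; _∸_; _≤_; _<_; z≤n; s≤s; _≤?_; NonZero; _%_; _/_)
open import Data.Nat.Properties
open import Data.Nat.DivMod using (m≡m%n+[m/n]*n; m%n<n; [m+kn]%n≡m%n; m<n⇒m%n≡m; n%n≡0)
open import Data.Nat.ListAction using (sum)
open import Data.Nat.ListAction.Properties using (sum-++)
import Data.Nat.Tactic.RingSolver as ℕ-Ring
open import Data.Integer as ℤ using (ℤ; +_; +≤+; _%ℕ_; _/ℕ_; _⊖_; ∣_∣)
import Data.Integer.Properties as ℤ
open import Data.Integer.DivMod using (a≡a%ℕn+[a/ℕn]*n; n%ℕd<d)
open import Data.Integer.Tactic.RingSolver using (solve-∀)
open import Data.List using (List; []; _∷_; length; map; filter; concatMap; _++_; replicate)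
open import Data.List.Properties using (length-map; length-++; map-∘; map-cong)
open import Data.List.Membership.Propositional using (_∈_)
open import Data.List.Membership.Propositional.Properties
  using (∈-concatMap⁺; ∈-filter⁺; ∈-filter⁻; ∈-map⁺; ∈-map⁻)
open import Data.List.Membership.Propositional.Properties.WithK using (unique∧set⇒bag)
open import Data.List.Relation.Unary.Any as Any using (here; there)
open import Data.List.Relation.Unary.All as All using (All; []; _∷_)
open import Data.List.Relation.Unary.AllPairs using ([]; _∷_)
open import Data.List.Relation.Unary.Unique.Propositional using (Unique)
import Data.List.Relation.Unary.Unique.Propositional.Properties as Unique
open import Data.List.Relation.Binary.BagAndSetEquality using (∼bag⇒↭)
open import Data.List.Relation.Binary.Permutation.Propositional.Properties using (↭-length)
open import Data.Vec as Vec using (Vec; []; _∷_; toList; lookup; tabulate)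
open import Data.Vec.Properties using (lookup∘tabulate; tabulate∘lookup; tabulate-cong; length-toList)
open import Data.Fin using (Fin; toℕ)
open import Data.Fin.Properties using (toℕ<n)
open import Data.Fin.Permutation using (Permutation′; _⟨$⟩ʳ_; inverseʳ; inverseˡ; flip)
import Algebra.Properties.CommutativeMonoid.Sum +-0-commutativeMonoid as Σ
open import Data.Maybe using (Maybe; just; nothing)
open import Data.Product using (_×_; _,_; proj₁; proj₂; ∃; ∃₂)
open import Data.Sum using (inj₁; inj₂)
open import Data.Unit using (⊤; tt)
open import Data.Empty using (⊥-elim)
open import Function using (_∘_; _⇔_; mk⇔; Equivalence)
open import Function.Properties.Equivalence using () renaming (trans to ⇔-trans)
open import Level using (0ℓ)
open import Relation.Nullary using (yes; no)
open import Relation.Unary using (Pred; Decidable)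
open import Relation.Binary.PropositionalEquality

open Equivalence using (to; from)

extensions : List Step → List (List Step)
extensions w = (U ∷ w) ∷ (D ∷ w) ∷ []

∈-extensions⇒∈ : ∀ {s v ws} → s ∷ v ∈ concatMap extensions ws → v ∈ ws
∈-extensions⇒∈ {ws = _ ∷ _} (here refl)         = here refl
∈-extensions⇒∈ {ws = _ ∷ _} (there (here refl)) = here refl
∈-extensions⇒∈ {ws = _ ∷ _} (there (there p))   = there (∈-extensions⇒∈ p)

∈-words : (w : List Step) → w ∈ words (length w)
∈-words []      = here refl
∈-words (U ∷ w) = ∈-concatMap⁺ extensions (Any.map (λ { refl → here refl }) (∈-words w))
∈-words (D ∷ w) = ∈-concatMap⁺ extensions (Any.map (λ { refl → there (here refl) }) (∈-words w))

words-unique : ∀ L → Unique (words L)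
words-unique zero    = [] ∷ []
words-unique (suc L) = extensions-unique (words-unique L)
  where
  fresh : ∀ {w ws} → All (w ≢_) ws → ∀ s → All (s ∷ w ≢_) (concatMap extensions ws)
  fresh w∉ws s = All.tabulate λ { v∈ refl → All.lookup w∉ws (∈-extensions⇒∈ v∈) refl }
  extensions-unique : ∀ {ws} → Unique ws → Unique (concatMap extensions ws)
  extensions-unique []             = []
  extensions-unique (w∉ws ∷ uniq) = ((λ ()) ∷ fresh w∉ws U) ∷ fresh w∉ws D ∷ extensions-unique uniq

∈-filter-words : ∀ {R : Pred (List Step) 0ℓ} (R? : Decidable R) {L} → (∀ {w} → R w → length w ≡ L) →
                 ∀ {w} → R w → w ∈ filter R? (words L)
∈-filter-words R? R⇒length {w} r = ∈-filter⁺ R? (subst (λ l → w ∈ words l) (R⇒length r) (∈-words w)) r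

filter-words-length-≡ : ∀ {P Q : Pred (List Step) 0ℓ} (P? : Decidable P) (Q? : Decidable Q)
  (f f⁻¹ : List Step → List Step) → (∀ w → f⁻¹ (f w) ≡ w) → (∀ w → f (f⁻¹ w) ≡ w) →
  (∀ {w} → P w → Q (f w)) → (∀ {w} → Q w → P (f⁻¹ w)) →
  ∀ L → (∀ {w} → P w → length w ≡ L) → (∀ {w} → Q w → length w ≡ L) →
  length (filter P? (words L)) ≡ length (filter Q? (words L))
filter-words-length-≡ P? Q? f f⁻¹ f⁻¹∘f f∘f⁻¹ P⇒Qf Q⇒Pf⁻¹ L P⇒length Q⇒length = begin
  length (filter P? (words L))          ≡⟨ length-map f (filter P? (words L)) ⟨
  length (map f (filter P? (words L)))  ≡⟨ ↭-length (∼bag⇒↭ (unique∧set⇒bag image-unique (Unique.filter⁺ Q? (words-unique L)) same-members)) ⟩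
  length (filter Q? (words L))          ∎
  where
  open ≡-Reasoning
  image-unique : Unique (map f (filter P? (words L)))
  image-unique = Unique.map⁺ (λ {v} {w} e → trans (sym (f⁻¹∘f v)) (trans (cong f⁻¹ e) (f⁻¹∘f w)))
                             (Unique.filter⁺ P? (words-unique L))
  same-members : ∀ {w} → w ∈ map f (filter P? (words L)) ⇔ w ∈ filter Q? (words L)
  same-members = mk⇔
    (λ w∈ → let _ , v∈ , w≡fv = ∈-map⁻ f w∈ in
            subst (_∈ _) (sym w≡fv) (∈-filter-words Q? Q⇒length (P⇒Qf (proj₂ (∈-filter⁻ P? {xs = words L} v∈)))))
    (λ w∈ → subst (_∈ _) (f∘f⁻¹ _)
              (∈-map⁺ f (∈-filter-words P? P⇒length (Q⇒Pf⁻¹ (proj₂ (∈-filter⁻ Q? {xs = words L} w∈))))))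

remainder-unique : ∀ {k r r′} (d : ℤ) → r < k → r′ < k → + r′ ℤ.- + r ≡ d ℤ.* + k → r′ ≡ r
remainder-unique {k} {r} {r′} d r<k r′<k r′-r≡dk =
  ℤ.+-injective (ℤ.i-j≡0⇒i≡j (+ r′) (+ r) (trans (ℤ.m-n≡m⊖n r′ r) (ℤ.∣i∣≡0⇒i≡0 ∣r′⊖r∣≡0)))
  where
  ∣r′⊖r∣≡∣d∣k : ∣ r′ ⊖ r ∣ ≡ ∣ d ∣ * k
  ∣r′⊖r∣≡∣d∣k = trans (cong ∣_∣ (trans (sym (ℤ.m-n≡m⊖n r′ r)) r′-r≡dk)) (ℤ.abs-* d (+ k))
  ∣r′⊖r∣<k : ∣ r′ ⊖ r ∣ < k
  ∣r′⊖r∣<k = ≤-<-trans (ℤ.∣m⊝n∣≤m⊔n r′ r) (⊔-lub r′<k r<k)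
  ∣r′⊖r∣≡0 : ∣ r′ ⊖ r ∣ ≡ 0
  ∣r′⊖r∣≡0 with ∣ d ∣ | ∣r′⊖r∣≡∣d∣k
  ... | zero  | e = e
  ... | suc _ | e = ⊥-elim (<⇒≱ ∣r′⊖r∣<k (subst (k ≤_) (sym e) (m≤m+n k _)))

%ℕ-unique : ∀ {k} .{{_ : NonZero k}} {r} (x q : ℤ) → r < k → x ≡ + r ℤ.+ q ℤ.* + k → x %ℕ k ≡ r
%ℕ-unique {k} {r} x q r<k x≡r+qk = remainder-unique (q ℤ.- x /ℕ k) r<k (n%ℕd<d x k) (begin
  + (x %ℕ k) ℤ.- + r                                            ≡⟨ cancel (+ (x %ℕ k)) (x /ℕ k ℤ.* + k) (+ r) ⟩
  ((+ (x %ℕ k) ℤ.+ x /ℕ k ℤ.* + k) ℤ.- x /ℕ k ℤ.* + k) ℤ.- + r  ≡⟨ cong (λ y → (y ℤ.- x /ℕ k ℤ.* + k) ℤ.- + r)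
                                                                        (trans (sym (a≡a%ℕn+[a/ℕn]*n x k)) x≡r+qk) ⟩
  ((+ r ℤ.+ q ℤ.* + k) ℤ.- x /ℕ k ℤ.* + k) ℤ.- + r              ≡⟨ collect (+ r) q (x /ℕ k) (+ k) ⟩
  (q ℤ.- x /ℕ k) ℤ.* + k                                         ∎)
  where
  open ≡-Reasoning
  cancel : ∀ a b c → a ℤ.- c ≡ ((a ℤ.+ b) ℤ.- b) ℤ.- c
  cancel = solve-∀
  collect : ∀ r q q′ k → ((r ℤ.+ q ℤ.* k) ℤ.- q′ ℤ.* k) ℤ.- r ≡ (q ℤ.- q′) ℤ.* k
  collect = solve-∀

[m-n*k]%ℕk≡m%k : ∀ {k} .{{_ : NonZero k}} m n → (+ m ℤ.- + (n * k)) %ℕ k ≡ m % k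
[m-n*k]%ℕk≡m%k {k} m n = %ℕ-unique _ (+ (m / k) ℤ.- + n) (m%n<n m k) (begin
  + m ℤ.- + (n * k)                                  ≡⟨ cong₂ ℤ._-_ (cong +_ (m≡m%n+[m/n]*n m k)) (ℤ.pos-* n k) ⟩
  + (m % k + m / k * k) ℤ.- + n ℤ.* + k              ≡⟨ cong (ℤ._- + n ℤ.* + k)
                                                           (trans (ℤ.pos-+ (m % k) _) (cong (ℤ._+_ (+ (m % k))) (ℤ.pos-* (m / k) k))) ⟩
  (+ (m % k) ℤ.+ + (m / k) ℤ.* + k) ℤ.- + n ℤ.* + k  ≡⟨ regroup (+ (m % k)) (+ (m / k)) (+ n) (+ k) ⟩
  + (m % k) ℤ.+ (+ (m / k) ℤ.- + n) ℤ.* + k          ∎)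
  where
  open ≡-Reasoning
  regroup : ∀ r q n k → (r ℤ.+ q ℤ.* k) ℤ.- n ℤ.* k ≡ r ℤ.+ (q ℤ.- n) ℤ.* k
  regroup = solve-∀

+1-shift : ∀ {h a} b → h ≡ + a ℤ.- b → h ℤ.+ + 1 ≡ + suc a ℤ.- b
+1-shift {a = a} b refl = shift (+ a) b
  where
  shift : ∀ a b → (a ℤ.- b) ℤ.+ + 1 ≡ (+ 1 ℤ.+ a) ℤ.- b
  shift = solve-∀

numU : List Step → ℕ
numU []      = 0
numU (U ∷ w) = suc (numU w)
numU (D ∷ w) = numU w

length≡numU+numD : ∀ w → length w ≡ numU w + numD w
length≡numU+numD []      = refl
length≡numU+numD (U ∷ w) = cong suc (length≡numU+numD w)
length≡numU+numD (D ∷ w) = trans (cong suc (length≡numU+numD w)) (sym (+-suc (numU w) (numD w)))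

endHeight≡ : ∀ k h w → endHeight k h w ≡ h ℤ.+ + numU w ℤ.- + (numD w * k)
endHeight≡ k h []      = sym (trans (ℤ.+-identityʳ _) (ℤ.+-identityʳ h))
endHeight≡ k h (U ∷ w) = trans (endHeight≡ k (h ℤ.+ + 1) w) (up h (+ numU w) (+ (numD w * k)))
  where
  up : ∀ h a b → (h ℤ.+ + 1) ℤ.+ a ℤ.- b ≡ h ℤ.+ (+ 1 ℤ.+ a) ℤ.- b
  up = solve-∀
endHeight≡ k h (D ∷ w) = trans (endHeight≡ k (h ℤ.- + k) w) (down h (+ numU w) (+ k) (+ (numD w * k)))
  where
  down : ∀ h a k b → (h ℤ.- k) ℤ.+ a ℤ.- b ≡ h ℤ.+ a ℤ.- (k ℤ.+ b)
  down = solve-∀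

numU≡numD*k : ∀ k w → endHeight k (+ 0) w ≡ + 0 → numU w ≡ numD w * k
numU≡numD*k k w end≡0 =
  ℤ.+-injective (ℤ.i-j≡0⇒i≡j (+ numU w) (+ (numD w * k)) (trans (sym (endHeight≡ k (+ 0) w)) end≡0))

InK-length : ∀ {m t n b w} → InK m t n b w → length w ≡ (suc m + 1) * n
InK-length {m} {n = n} {w = w} ((numD≡n , end≡0 , _) , _) = begin
  length w                 ≡⟨ length≡numU+numD w ⟩
  numU w + numD w          ≡⟨ cong (_+ numD w) (numU≡numD*k (suc m) w end≡0) ⟩
  numD w * suc m + numD w  ≡⟨ cong (λ d → d * suc m + d) numD≡n ⟩
  n * suc m + n            ≡⟨ regroup m n ⟩
  (suc m + 1) * n          ∎
  where
  open ≡-Reasoning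
  regroup : ∀ m n → n * suc m + n ≡ (suc m + 1) * n
  regroup = ℕ-Ring.solve-∀

-- Heights shifted up by t, so that the floor y = -t becomes 0.
StaysNonneg : ℕ → ℕ → List Step → Set
StaysNonneg k H []      = ⊤
StaysNonneg k H (U ∷ w) = StaysNonneg k (suc H) w
StaysNonneg k H (D ∷ w) = k ≤ H × StaysNonneg k (H ∸ k) w

module _ {k t : ℕ} where

  private
    down-step : ∀ {h H} → k ≤ H → h ≡ + H ℤ.- + t → h ℤ.- + k ≡ + (H ∸ k) ℤ.- + t
    down-step {H = H} k≤H refl = trans (swap (+ H) (+ t) (+ k)) (cong (ℤ._- + t) (trans (ℤ.m-n≡m⊖n H k) (ℤ.⊖-≥ k≤H)))
      where
      swap : ∀ a b c → (a ℤ.- b) ℤ.- c ≡ (a ℤ.- c) ℤ.- b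
      swap = solve-∀

    above-floor : ∀ H → ℤ.- + t ℤ.≤ + H ℤ.- + t
    above-floor H = subst (ℤ._≤ + H ℤ.- + t) (ℤ.+-identityˡ (ℤ.- + t)) (ℤ.+-monoˡ-≤ (ℤ.- + t) (+≤+ z≤n))

    down-allowed : ∀ {H} → ℤ.- + t ℤ.≤ (+ H ℤ.- + t) ℤ.- + k → k ≤ H
    down-allowed {H} ≤h =
      ℤ.drop‿+≤+ (subst₂ ℤ._≤_ (cancelˡ (+ t) (+ k)) (cancelʳ (+ H) (+ t) (+ k)) (ℤ.+-monoˡ-≤ (+ t ℤ.+ + k) ≤h))
      where
      cancelˡ : ∀ a b → ℤ.- a ℤ.+ (a ℤ.+ b) ≡ b
      cancelˡ = solve-∀
      cancelʳ : ∀ a b c → ((a ℤ.- b) ℤ.- c) ℤ.+ (b ℤ.+ c) ≡ a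
      cancelʳ = solve-∀

  heights≥⇔StaysNonneg : ∀ w {h H} → h ≡ + H ℤ.- + t →
                         All (ℤ.- + t ℤ.≤_) (heights k h w) ⇔ StaysNonneg k H w
  heights≥⇔StaysNonneg []      h≡ = mk⇔ (λ _ → tt) (λ _ → [])
  heights≥⇔StaysNonneg (U ∷ w) {h} {H} h≡ = mk⇔
    (λ { (_ ∷ rest) → to IH rest })
    (λ nonneg → subst (ℤ.- + t ℤ.≤_) (sym (+1-shift (+ t) h≡)) (above-floor (suc H)) ∷ from IH nonneg)
    where
    IH : All (ℤ.- + t ℤ.≤_) (heights k (h ℤ.+ + 1) w) ⇔ StaysNonneg k (suc H) w
    IH = heights≥⇔StaysNonneg w (+1-shift (+ t) h≡)
  heights≥⇔StaysNonneg (D ∷ w) {h} {H} h≡ = mk⇔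
    (λ { (≤h ∷ rest) → let k≤H = down-allowed (subst (λ y → ℤ.- + t ℤ.≤ y ℤ.- + k) h≡ ≤h) in
                         k≤H , to (IH k≤H) rest })
    (λ { (k≤H , nonneg) → subst (ℤ.- + t ℤ.≤_) (sym (down-step k≤H h≡)) (above-floor (H ∸ k)) ∷ from (IH k≤H) nonneg })
    where
    IH : k ≤ H → All (ℤ.- + t ℤ.≤_) (heights k (h ℤ.- + k) w) ⇔ StaysNonneg k (H ∸ k) w
    IH k≤H = heights≥⇔StaysNonneg w (down-step k≤H h≡)

-- A down-step ends at height ρ - k·d, where ρ counts the up-steps before it and d the
-- down-steps up to it; modulo k only ρ matters.
upsBeforeDowns : ℕ → List Step → List ℤ
upsBeforeDowns ρ []      = []
upsBeforeDowns ρ (U ∷ w) = upsBeforeDowns (suc ρ) w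
upsBeforeDowns ρ (D ∷ w) = + ρ ∷ upsBeforeDowns ρ w

module _ {k : ℕ} .{{_ : NonZero k}} {r : ℕ} where

  countMod-∷ : ∀ {x y xs ys} → x %ℕ k ≡ y %ℕ k → countMod k r xs ≡ countMod k r ys →
               countMod k r (x ∷ xs) ≡ countMod k r (y ∷ ys)
  countMod-∷ {x} {y} x≡y xs≡ys with x %ℕ k ℕ.≟ r % k | y %ℕ k ℕ.≟ r % k
  ... | yes _   | yes _   = cong suc xs≡ys
  ... | no  _   | no  _   = xs≡ys
  ... | yes x≡r | no  y≢r = ⊥-elim (y≢r (trans (sym x≡y) x≡r))
  ... | no  x≢r | yes y≡r = ⊥-elim (x≢r (trans x≡y y≡r))

  countMod-downEnds : ∀ w {h} ρ d → h ≡ + ρ ℤ.- + (d * k) →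
                      countMod k r (downEnds k h w) ≡ countMod k r (upsBeforeDowns ρ w)
  countMod-downEnds []      ρ d h≡ = refl
  countMod-downEnds (U ∷ w) ρ d h≡ = countMod-downEnds w (suc ρ) d (+1-shift (+ (d * k)) h≡)
  countMod-downEnds (D ∷ w) {h} ρ d h≡ =
    countMod-∷ {x = h ℤ.- + k} {y = + ρ} (trans (cong (_%ℕ k) (down h≡)) ([m-n*k]%ℕk≡m%k ρ (suc d)))
               (countMod-downEnds w ρ (suc d) (down h≡))
    where
    down : ∀ {h} → h ≡ + ρ ℤ.- + (d * k) → h ℤ.- + k ≡ + ρ ℤ.- + (suc d * k)
    down refl = shift (+ ρ) (+ (d * k)) (+ k)
      where
      shift : ∀ a b c → (a ℤ.- b) ℤ.- c ≡ a ℤ.- (c ℤ.+ b)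
      shift = solve-∀

  countMod-replicate-≡ : ∀ {x} c l → x %ℕ k ≡ r % k → countMod k r (replicate c x ++ l) ≡ c + countMod k r l
  countMod-replicate-≡ zero    l _ = refl
  countMod-replicate-≡ {x} (suc c) l x≡r with x %ℕ k ℕ.≟ r % k
  ... | yes _   = cong suc (countMod-replicate-≡ c l x≡r)
  ... | no  x≢r = ⊥-elim (x≢r x≡r)

  countMod-replicate-≢ : ∀ {x} c l → x %ℕ k ≢ r % k → countMod k r (replicate c x ++ l) ≡ countMod k r l
  countMod-replicate-≢ zero    l _ = refl
  countMod-replicate-≢ {x} (suc c) l x≢r with x %ℕ k ℕ.≟ r % k
  ... | yes x≡r = ⊥-elim (x≢r x≡r)
  ... | no  _   = countMod-replicate-≢ c l x≢r

-- Blocks and windows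

blocks : List ℕ → List Step
blocks []       = []
blocks (c ∷ cs) = U ∷ replicate c D ++ blocks cs

decode : ℕ × List ℕ → List Step
decode (c , cs) = replicate c D ++ blocks cs

encode : List Step → ℕ × List ℕ
encode []      = 0 , []
encode (D ∷ w) = let c , cs = encode w in suc c , cs
encode (U ∷ w) = let c , cs = encode w in 0 , c ∷ cs

decode∘encode : ∀ w → decode (encode w) ≡ w
decode∘encode []      = refl
decode∘encode (D ∷ w) = cong (D ∷_) (decode∘encode w)
decode∘encode (U ∷ w) = cong (U ∷_) (decode∘encode w)

encode∘decode : ∀ c cs → encode (decode (c , cs)) ≡ (c , cs)
encode∘decode (suc c) cs       rewrite encode∘decode c cs = refl
encode∘decode zero    []       = refl
encode∘decode zero    (c ∷ cs) rewrite encode∘decode c cs = refl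

numD-D^c : ∀ c w → numD (replicate c D ++ w) ≡ c + numD w
numD-D^c zero    w = refl
numD-D^c (suc c) w = cong suc (numD-D^c c w)

numU-D^c : ∀ c w → numU (replicate c D ++ w) ≡ numU w
numU-D^c zero    w = refl
numU-D^c (suc c) w = numU-D^c c w

numD-blocks : ∀ cs → numD (blocks cs) ≡ sum cs
numD-blocks []       = refl
numD-blocks (c ∷ cs) = trans (numD-D^c c (blocks cs)) (cong (_+_ c) (numD-blocks cs))

numU-blocks : ∀ cs → numU (blocks cs) ≡ length cs
numU-blocks []       = refl
numU-blocks (c ∷ cs) = cong suc (trans (numU-D^c c (blocks cs)) (numU-blocks cs))

upsBeforeDowns-D^c : ∀ ρ c w → upsBeforeDowns ρ (replicate c D ++ w) ≡ replicate c (+ ρ) ++ upsBeforeDowns ρ w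
upsBeforeDowns-D^c ρ zero    w = refl
upsBeforeDowns-D^c ρ (suc c) w = cong (+ ρ ∷_) (upsBeforeDowns-D^c ρ c w)

takeWindow : ∀ j → List ℕ → Maybe (Vec ℕ j × List ℕ)
takeWindow zero    cs       = just ([] , cs)
takeWindow (suc j) []       = nothing
takeWindow (suc j) (c ∷ cs) with takeWindow j cs
... | just (v , r) = just (c ∷ v , r)
... | nothing      = nothing

takeWindow-just : ∀ j cs {v r} → takeWindow j cs ≡ just (v , r) → cs ≡ toList v ++ r
takeWindow-just zero    cs       refl = refl
takeWindow-just (suc j) (c ∷ cs) eq with takeWindow j cs in eq′
takeWindow-just (suc j) (c ∷ cs) refl | just (v , r) = cong (c ∷_) (takeWindow-just j cs eq′)

takeWindow-toList : ∀ {j} (v : Vec ℕ j) r → takeWindow j (toList v ++ r) ≡ just (v , r)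
takeWindow-toList []      r = refl
takeWindow-toList (c ∷ v) r rewrite takeWindow-toList v r = refl

split-toList++ : ∀ j {l} cs → length cs ≡ j + l → ∃₂ λ (v : Vec ℕ j) r → cs ≡ toList v ++ r × length r ≡ l
split-toList++ zero    cs       eq = [] , cs , refl , eq
split-toList++ (suc j) (c ∷ cs) eq with split-toList++ j cs (suc-injective eq)
... | v , r , refl , eq′ = c ∷ v , r , refl , eq′

windowSum : ∀ {r} → Vec ℕ r → ℕ
windowSum v = sum (toList v)

sum-toList≡Σ : ∀ {r} (v : Vec ℕ r) → sum (toList v) ≡ Σ.sum (lookup v)
sum-toList≡Σ []      = refl
sum-toList≡Σ (c ∷ v) = cong (_+_ c) (sum-toList≡Σ v)

columnSum : ∀ {K} → List (Vec ℕ K) → Fin K → ℕ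
columnSum ws i = sum (map (λ v → lookup v i) ws)

module _ {K : ℕ} where

  flatten : List (Vec ℕ K) → List ℕ
  flatten = concatMap toList

  windows : ∀ n cs → length cs ≡ n * K → ∃ λ ws → length ws ≡ n × cs ≡ flatten ws
  windows zero    []  _  = [] , refl , refl
  windows (suc n) cs  eq with split-toList++ K cs eq
  ... | v , r , refl , eq′ with windows n r eq′
  ...   | ws , refl , refl = v ∷ ws , refl , refl

  sum-flatten : (ws : List (Vec ℕ K)) → sum (flatten ws) ≡ sum (map windowSum ws)
  sum-flatten []       = refl
  sum-flatten (v ∷ ws) = trans (sum-++ (toList v) (flatten ws)) (cong (_+_ (windowSum v)) (sum-flatten ws))

  length-flatten : (ws : List (Vec ℕ K)) → length (flatten ws) ≡ length ws * K
  length-flatten []       = refl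
  length-flatten (v ∷ ws) = trans (length-++ (toList v)) (cong₂ _+_ (length-toList v) (length-flatten ws))

  permute : (Fin K → Fin K) → Vec ℕ K → Vec ℕ K
  permute π v = tabulate (lookup v ∘ π)

  permute-inverse : ∀ {π π′} → (∀ i → π (π′ i) ≡ i) → ∀ v → permute π′ (permute π v) ≡ v
  permute-inverse {π′ = π′} inv v =
    trans (tabulate-cong λ i → trans (lookup∘tabulate _ (π′ i)) (cong (lookup v) (inv i))) (tabulate∘lookup v)

  permuteWindows : (Fin K → Fin K) → ℕ → List ℕ → List ℕ
  permuteWindows π zero    cs = cs
  permuteWindows π (suc n) cs with takeWindow K cs
  ... | just (v , r) = toList (permute π v) ++ permuteWindows π n r
  ... | nothing      = cs

  permuteWindows-inverse : ∀ {π π′} → (∀ i → π (π′ i) ≡ i) → ∀ n cs → permuteWindows π′ n (permuteWindows π n cs) ≡ cs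
  permuteWindows-inverse inv zero cs = refl
  permuteWindows-inverse {π} inv (suc n) cs with takeWindow K cs in eq
  ... | nothing rewrite eq = refl
  ... | just (v , r) rewrite takeWindow-toList (permute π v) (permuteWindows π n r) =
    trans (cong₂ (λ u rest → toList u ++ rest) (permute-inverse inv v) (permuteWindows-inverse inv n r))
          (sym (takeWindow-just K cs eq))

  permuteWindows-flatten : ∀ π ws → permuteWindows π (length ws) (flatten ws) ≡ flatten (map (permute π) ws)
  permuteWindows-flatten π []       = refl
  permuteWindows-flatten π (v ∷ ws) rewrite takeWindow-toList v (flatten ws) =
    cong (toList (permute π v) ++_) (permuteWindows-flatten π ws)

  windowSum-permute : ∀ (σ : Permutation′ K) v → windowSum (permute (σ ⟨$⟩ʳ_) v) ≡ windowSum v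
  windowSum-permute σ v = begin
    sum (toList (permute (σ ⟨$⟩ʳ_) v))                ≡⟨ sum-toList≡Σ (permute (σ ⟨$⟩ʳ_) v) ⟩
    Σ.sum (lookup (tabulate (lookup v ∘ (σ ⟨$⟩ʳ_))))  ≡⟨ Σ.sum-cong-≗ (lookup∘tabulate (lookup v ∘ (σ ⟨$⟩ʳ_))) ⟩
    Σ.sum (lookup v ∘ (σ ⟨$⟩ʳ_))                      ≡⟨ Σ.sum-permute (lookup v) σ ⟨
    Σ.sum (lookup v)                                  ≡⟨ sum-toList≡Σ v ⟨
    sum (toList v)                                    ∎
    where open ≡-Reasoning

  columnSum-permute : ∀ π (ws : List (Vec ℕ K)) i → columnSum (map (permute π) ws) i ≡ columnSum ws (π i)
  columnSum-permute π []       i = refl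
  columnSum-permute π (v ∷ ws) i = cong₂ _+_ (lookup∘tabulate _ i) (columnSum-permute π ws i)

-- The floor condition on windows

-- T is the number of down-steps affordable at the start of a window: there the shifted
-- height is T·k - 1.
WithinBudget : ℕ → List ℕ → Set
WithinBudget T []       = ⊤
WithinBudget T (s ∷ ss) = s ≤ T × WithinBudget (suc (T ∸ s)) ss

≤×≤∸⇔+≤ : ∀ {a b n} → (a ≤ n × b ≤ n ∸ a) ⇔ a + b ≤ n
≤×≤∸⇔+≤ {a} {b} {n} = mk⇔
  (λ { (a≤n , b≤n∸a) → subst (_≤ n) (+-comm b a) (m≤o∸n⇒m+n≤o b a≤n b≤n∸a) })
  (λ a+b≤n → m+n≤o⇒m≤o a a+b≤n , m+n≤o⇒m≤o∸n b (subst (_≤ n) (+-comm a b) a+b≤n))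

module _ {K : ℕ} where

  StaysNonneg-D^c : ∀ c H w → StaysNonneg K H (replicate c D ++ w) ⇔ (c * K ≤ H × StaysNonneg K (H ∸ c * K) w)
  StaysNonneg-D^c zero    H w = mk⇔ (z≤n ,_) proj₂
  StaysNonneg-D^c (suc c) H w = mk⇔
    (λ { (K≤H , rest) → let cK≤ , rest′ = to IH rest in
           subst (K + c * K ≤_) (m+[n∸m]≡n K≤H) (+-monoʳ-≤ K cK≤) ,
           subst (λ x → StaysNonneg K x w) (∸-+-assoc H K (c * K)) rest′ })
    (λ { (KcK≤H , rest) → m+n≤o⇒m≤o K KcK≤H ,
           from IH (m+n≤o⇒m≤o∸n (c * K) (subst (_≤ H) (+-comm K (c * K)) KcK≤H) ,
                    subst (λ x → StaysNonneg K x w) (sym (∸-+-assoc H K (c * K))) rest) })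
    where
    IH : StaysNonneg K (H ∸ K) (replicate c D ++ w) ⇔ (c * K ≤ H ∸ K × StaysNonneg K (H ∸ K ∸ c * K) w)
    IH = StaysNonneg-D^c c (H ∸ K) w

  m*k≤n*k+r⇒m≤n : ∀ {m n r} → r < K → m * K ≤ n * K + r → m ≤ n
  m*k≤n*k+r⇒m≤n {m} {n} {r} r<K le with m ≤? n
  ... | yes m≤n = m≤n
  ... | no  m≰n = ⊥-elim (<⇒≱ r<K (+-cancelˡ-≤ (n * K) K r
                    (subst (_≤ n * K + r) (+-comm K (n * K)) (≤-trans (*-monoˡ-≤ K (≰⇒> m≰n)) le))))

  StaysNonneg-block : ∀ {c cs p T H} → p < K → suc H ≡ T * K + p →
    StaysNonneg K H (blocks (c ∷ cs)) ⇔ (c ≤ T × StaysNonneg K ((T ∸ c) * K + p) (blocks cs))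
  StaysNonneg-block {c} {cs} {p} {T} {H} p<K sucH≡ = mk⇔
    (λ nonneg → let cK≤ , rest = to D^c nonneg
                    c≤T = m*k≤n*k+r⇒m≤n p<K (subst (c * K ≤_) sucH≡ cK≤)
                in c≤T , subst (λ x → StaysNonneg K x (blocks cs)) (remaining c≤T) rest)
    (λ { (c≤T , rest) → from D^c
           ( subst (c * K ≤_) (sym sucH≡) (≤-trans (*-monoˡ-≤ K c≤T) (m≤m+n (T * K) p))
           , subst (λ x → StaysNonneg K x (blocks cs)) (sym (remaining c≤T)) rest) })
    where
    D^c : StaysNonneg K (suc H) (replicate c D ++ blocks cs) ⇔ (c * K ≤ suc H × StaysNonneg K (suc H ∸ c * K) (blocks cs))
    D^c = StaysNonneg-D^c c (suc H) (blocks cs)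
    remaining : c ≤ T → suc H ∸ c * K ≡ (T ∸ c) * K + p
    remaining c≤T = begin
      suc H ∸ c * K          ≡⟨ cong (_∸ c * K) sucH≡ ⟩
      T * K + p ∸ c * K      ≡⟨ +-∸-comm p (*-monoˡ-≤ K c≤T) ⟩
      (T * K ∸ c * K) + p    ≡⟨ cong (_+ p) (*-distribʳ-∸ K T c) ⟨
      (T ∸ c) * K + p        ∎
      where open ≡-Reasoning

  StaysNonneg-window : ∀ {r} (u : Vec ℕ r) rest {p T H H′} → p + r ≤ K → suc H ≡ T * K + p →
    suc H′ ≡ (T ∸ windowSum u) * K + (p + r) →
    StaysNonneg K H (blocks (toList u ++ rest)) ⇔ (windowSum u ≤ T × StaysNonneg K H′ (blocks rest))
  StaysNonneg-window [] rest {p} {T} {H} {H′} _ sucH≡ sucH′≡ = mk⇔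
    (λ nonneg → z≤n , subst (λ x → StaysNonneg K x (blocks rest)) H≡H′ nonneg)
    (λ (_ , nonneg) → subst (λ x → StaysNonneg K x (blocks rest)) (sym H≡H′) nonneg)
    where
    H≡H′ : H ≡ H′
    H≡H′ = suc-injective (trans sucH≡ (trans (cong (_+_ (T * K)) (sym (+-identityʳ p))) (sym sucH′≡)))
  StaysNonneg-window {suc r} (c ∷ u) rest {p} {T} {H} {H′} p+r≤K sucH≡ sucH′≡ = mk⇔
    (λ nonneg → let c≤T , rest′ = to block nonneg
                    s≤T∸c , rest″ = to IH rest′
                in to ≤×≤∸⇔+≤ (c≤T , s≤T∸c) , rest″)
    (λ { (s≤T , nonneg) → let c≤T , s≤T∸c = from ≤×≤∸⇔+≤ s≤T in from block (c≤T , from IH (s≤T∸c , nonneg)) })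
    where
    p<K : p < K
    p<K = ≤-trans (s≤s (m≤m+n p r)) (subst (_≤ K) (+-suc p r) p+r≤K)
    block : StaysNonneg K H (blocks (c ∷ toList u ++ rest)) ⇔ (c ≤ T × StaysNonneg K ((T ∸ c) * K + p) (blocks (toList u ++ rest)))
    block = StaysNonneg-block p<K sucH≡
    IH : StaysNonneg K ((T ∸ c) * K + p) (blocks (toList u ++ rest)) ⇔ (windowSum u ≤ T ∸ c × StaysNonneg K H′ (blocks rest))
    IH = StaysNonneg-window u rest (subst (_≤ K) (+-suc p r) p+r≤K) (sym (+-suc _ p))
           (trans sucH′≡ (cong₂ (λ a b → a * K + b) (sym (∸-+-assoc T c (windowSum u))) (+-suc p r)))

StaysNonneg-windows : ∀ {k} (ws : List (Vec ℕ (suc k))) {H T} → suc H ≡ T * suc k →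
  StaysNonneg (suc k) H (blocks (flatten ws)) ⇔ WithinBudget T (map windowSum ws)
StaysNonneg-windows []       _ = mk⇔ (λ _ → tt) (λ _ → tt)
StaysNonneg-windows {k} (v ∷ ws) {H} {T} sucH≡ = mk⇔
  (λ nonneg → let s≤T , rest = to window nonneg in s≤T , to IH rest)
  (λ { (s≤T , rest) → from window (s≤T , from IH rest) })
  where
  H′ : ℕ
  H′ = (T ∸ windowSum v) * suc k + k
  window : StaysNonneg (suc k) H (blocks (flatten (v ∷ ws))) ⇔ (windowSum v ≤ T × StaysNonneg (suc k) H′ (blocks (flatten ws)))
  window = StaysNonneg-window v (flatten ws) ≤-refl (trans sucH≡ (sym (+-identityʳ _))) (sym (+-suc _ k))
  IH : StaysNonneg (suc k) H′ (blocks (flatten ws)) ⇔ WithinBudget (suc (T ∸ windowSum v)) (map windowSum ws)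
  IH = StaysNonneg-windows ws (cong suc (+-comm _ k))

-- Class counts on windows

entryAt : ℕ → ∀ {r} → Vec ℕ r → ℕ → ℕ
entryAt p []      j = 0
entryAt p (c ∷ u) j with p ℕ.≟ j
... | yes _ = c
... | no  _ = entryAt (suc p) u j

entryAt-< : ∀ {r} p (u : Vec ℕ r) {j} → j < p → entryAt p u j ≡ 0
entryAt-< p []      j<p = refl
entryAt-< p (c ∷ u) {j} j<p with p ℕ.≟ j
... | yes refl = ⊥-elim (<-irrefl refl j<p)
... | no  _    = entryAt-< (suc p) u (m<n⇒m<1+n j<p)

entryAt-lookup : ∀ {r} p (u : Vec ℕ r) i → entryAt p u (p + toℕ i) ≡ lookup u i
entryAt-lookup p (c ∷ u) Fin.zero with p ℕ.≟ p + 0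
... | yes _   = refl
... | no  p≢p = ⊥-elim (p≢p (sym (+-identityʳ p)))
entryAt-lookup p (c ∷ u) (Fin.suc i) with p ℕ.≟ p + suc (toℕ i)
... | yes p≡ = ⊥-elim (m≢1+m+n p (trans p≡ (+-suc p (toℕ i))))
... | no  _  = trans (cong (entryAt (suc p) u) (+-suc p (toℕ i))) (entryAt-lookup (suc p) u i)

suc-%-injective : ∀ {K p i} .{{_ : NonZero K}} → p < K → i < K → suc p % K ≡ suc i % K → p ≡ i
suc-%-injective {K} p<K i<K eq with m≤n⇒m<n∨m≡n p<K | m≤n⇒m<n∨m≡n i<K
... | inj₁ 1+p<K | inj₁ 1+i<K = suc-injective (trans (sym (m<n⇒m%n≡m 1+p<K)) (trans eq (m<n⇒m%n≡m 1+i<K)))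
... | inj₂ 1+p≡K | inj₂ 1+i≡K = suc-injective (trans 1+p≡K (sym 1+i≡K))
... | inj₁ 1+p<K | inj₂ refl  = ⊥-elim (1+n≢0 (trans (sym (m<n⇒m%n≡m 1+p<K)) (trans eq (n%n≡0 K))))
... | inj₂ refl  | inj₁ 1+i<K = ⊥-elim (1+n≢0 (trans (sym (m<n⇒m%n≡m 1+i<K)) (trans (sym eq) (n%n≡0 K))))

module _ {K : ℕ} .{{_ : NonZero K}} where

  [1+qK+p]%K≡[1+p]%K : ∀ q p → suc (q * K + p) % K ≡ suc p % K
  [1+qK+p]%K≡[1+p]%K q p = trans (cong (λ x → suc x % K) (+-comm (q * K) p)) ([m+kn]%n≡m%n (suc p) q K)

  countMod-window : ∀ {r} (u : Vec ℕ r) rest q p (i : Fin K) → p + r ≤ K →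
    countMod K (suc (toℕ i)) (upsBeforeDowns (q * K + p) (blocks (toList u ++ rest)))
      ≡ entryAt p u (toℕ i) + countMod K (suc (toℕ i)) (upsBeforeDowns (q * K + (p + r)) (blocks rest))
  countMod-window [] rest q p i _ = cong (λ x → countMod K _ (upsBeforeDowns (q * K + x) (blocks rest))) (sym (+-identityʳ p))
  countMod-window {suc r} (c ∷ u) rest q p i p+r≤K = begin
    countMod K j (upsBeforeDowns ρ (replicate c D ++ B)) ≡⟨ cong (countMod K j) (upsBeforeDowns-D^c ρ c B) ⟩
    countMod K j (replicate c (+ ρ) ++ ups)             ≡⟨ first-block ⟩
    entryAt p (c ∷ u) (toℕ i) + countMod K j ups′       ∎
    where
    open ≡-Reasoning
    j ρ : ℕ
    j = suc (toℕ i)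
    ρ = suc (q * K + p)
    B : List Step
    B = blocks (toList u ++ rest)
    ups ups′ : List ℤ
    ups = upsBeforeDowns ρ B
    ups′ = upsBeforeDowns (q * K + (p + suc r)) (blocks rest)

    rest-of-window : countMod K j ups ≡ entryAt (suc p) u (toℕ i) + countMod K j ups′
    rest-of-window = begin
      countMod K j ups                                  ≡⟨ cong (λ x → countMod K j (upsBeforeDowns x B)) (+-suc (q * K) p) ⟨
      countMod K j (upsBeforeDowns (q * K + suc p) B)   ≡⟨ countMod-window u rest q (suc p) i (subst (_≤ K) (+-suc p r) p+r≤K) ⟩
      entryAt (suc p) u (toℕ i) + countMod K j (upsBeforeDowns (q * K + (suc p + r)) (blocks rest))
        ≡⟨ cong (λ x → entryAt (suc p) u (toℕ i) + countMod K j (upsBeforeDowns (q * K + x) (blocks rest))) (+-suc p r) ⟨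
      entryAt (suc p) u (toℕ i) + countMod K j ups′     ∎

    first-block : countMod K j (replicate c (+ ρ) ++ ups) ≡ entryAt p (c ∷ u) (toℕ i) + countMod K j ups′
    first-block with p ℕ.≟ toℕ i
    ... | yes p≡i = begin
      countMod K j (replicate c (+ ρ) ++ ups)              ≡⟨ countMod-replicate-≡ c ups
                                                               (trans ([1+qK+p]%K≡[1+p]%K q p) (cong (λ x → suc x % K) p≡i)) ⟩
      c + countMod K j ups                                 ≡⟨ cong (_+_ c) rest-of-window ⟩
      c + (entryAt (suc p) u (toℕ i) + countMod K j ups′)  ≡⟨ cong (λ x → c + (x + countMod K j ups′))
                                                               (entryAt-< (suc p) u (s≤s (≤-reflexive (sym p≡i)))) ⟩
      c + countMod K j ups′                                ∎
    ... | no  p≢i = trans (countMod-replicate-≢ c ups ρ≢j) rest-of-window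
      where
      p<K : p < K
      p<K = ≤-trans (s≤s (m≤m+n p r)) (subst (_≤ K) (+-suc p r) p+r≤K)
      ρ≢j : ρ % K ≢ j % K
      ρ≢j ρ≡j = p≢i (suc-%-injective p<K (toℕ<n i) (trans (sym ([1+qK+p]%K≡[1+p]%K q p)) ρ≡j))

  countMod-windows : ∀ ws q (i : Fin K) →
    countMod K (suc (toℕ i)) (upsBeforeDowns (q * K) (blocks (flatten ws))) ≡ columnSum ws i
  countMod-windows []       q i = refl
  countMod-windows (v ∷ ws) q i = begin
    countMod K j (upsBeforeDowns (q * K) (blocks (toList v ++ flatten ws)))
      ≡⟨ cong (λ x → countMod K j (upsBeforeDowns x (blocks (toList v ++ flatten ws)))) (+-identityʳ (q * K)) ⟨
    countMod K j (upsBeforeDowns (q * K + 0) (blocks (toList v ++ flatten ws)))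
      ≡⟨ countMod-window v (flatten ws) q 0 i ≤-refl ⟩
    entryAt 0 v (toℕ i) + countMod K j (upsBeforeDowns (q * K + K) (blocks (flatten ws)))
      ≡⟨ cong₂ _+_ (entryAt-lookup 0 v i)
                   (trans (cong (λ x → countMod K j (upsBeforeDowns x (blocks (flatten ws)))) (+-comm (q * K) K))
                          (countMod-windows ws (suc q) i)) ⟩
    lookup v i + columnSum ws i
      ∎
    where
    open ≡-Reasoning
    j : ℕ
    j = suc (toℕ i)

-- Permuting inside windows

module _ {m : ℕ} where

  numD-windows : (ws : List (Vec ℕ (suc m))) → numD (blocks (flatten ws)) ≡ sum (map windowSum ws)
  numD-windows ws = trans (numD-blocks (flatten ws)) (sum-flatten ws)

  endHeight-windows : (ws : List (Vec ℕ (suc m))) →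
    endHeight (suc m) (+ 0) (blocks (flatten ws)) ≡ + (length ws * suc m) ℤ.- + (sum (map windowSum ws) * suc m)
  endHeight-windows ws =
    trans (endHeight≡ (suc m) (+ 0) (blocks (flatten ws)))
          (cong₂ (λ u d → + u ℤ.- + (d * suc m)) (trans (numU-blocks (flatten ws)) (length-flatten ws)) (numD-windows ws))

  heights-windows⇔WithinBudget : (ws : List (Vec ℕ (suc m))) →
    All (ℤ.- + m ℤ.≤_) (heights (suc m) (+ 0) (blocks (flatten ws))) ⇔ WithinBudget 1 (map windowSum ws)
  heights-windows⇔WithinBudget ws = ⇔-trans
    (heights≥⇔StaysNonneg (blocks (flatten ws)) (sym (ℤ.+-inverseʳ (+ m))))
    (StaysNonneg-windows ws (sym (*-identityˡ (suc m))))

  classCount-windows : (ws : List (Vec ℕ (suc m))) (i : Fin (suc m)) →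
    countMod (suc m) (suc (toℕ i)) (downEnds (suc m) (+ 0) (blocks (flatten ws))) ≡ columnSum ws i
  classCount-windows ws i = trans (countMod-downEnds (blocks (flatten ws)) 0 0 refl) (countMod-windows ws 0 i)

  InK-windowed : ∀ {n b w} → InK m m n b w → ∃ λ (ws : List (Vec ℕ (suc m))) → length ws ≡ n × w ≡ blocks (flatten ws)
  InK-windowed {n} {w = w} ((numD≡n , end≡0 , above) , _) with encode w | decode∘encode w
  ... | suc c , cs | refl =
    ⊥-elim (n≮n m (proj₁ (to (heights≥⇔StaysNonneg w (sym (ℤ.+-inverseʳ (+ m)))) above)))
  ... | zero  , cs | refl
    with windows n cs (trans (sym (numU-blocks cs)) (trans (numU≡numD*k (suc m) w end≡0) (cong (_* suc m) numD≡n)))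
  ...   | ws , length≡n , refl = ws , length≡n , refl

  InK-windows : ∀ {n} {b b′ : Fin (suc m) → ℕ} (π : Fin (suc m) → Fin (suc m)) (ws ws′ : List (Vec ℕ (suc m))) →
    map windowSum ws′ ≡ map windowSum ws → (∀ i → columnSum ws′ i ≡ columnSum ws (π i)) → (∀ i → b′ i ≡ b (π i)) →
    InK m m n b (blocks (flatten ws)) → InK m m n b′ (blocks (flatten ws′))
  InK-windows {b = b} {b′} π ws ws′ sums≡ columns≡ b′≡ ((numD≡n , end≡0 , above) , classes) =
    ( ( trans (numD-windows ws′) (trans (cong sum sums≡) (trans (sym (numD-windows ws)) numD≡n))
      , trans (endHeight-windows ws′) (trans (cong₂ (λ l s → + (l * suc m) ℤ.- + (sum s * suc m)) length≡ sums≡)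
                                               (trans (sym (endHeight-windows ws)) end≡0))
      , from (heights-windows⇔WithinBudget ws′)
          (subst (WithinBudget 1) (sym sums≡) (to (heights-windows⇔WithinBudget ws) above)) )
    , λ i → begin
        countMod (suc m) (suc (toℕ i)) (downEnds (suc m) (+ 0) (blocks (flatten ws′)))     ≡⟨ classCount-windows ws′ i ⟩
        columnSum ws′ i                                                                  ≡⟨ columns≡ i ⟩
        columnSum ws (π i)                                                               ≡⟨ classCount-windows ws (π i) ⟨
        countMod (suc m) (suc (toℕ (π i))) (downEnds (suc m) (+ 0) (blocks (flatten ws))) ≡⟨ classes (π i) ⟩
        b (π i)                                                                          ≡⟨ b′≡ i ⟨
        b′ i                                                                             ∎ )
    where
    open ≡-Reasoning
    length≡ : length ws′ ≡ length ws
    length≡ = trans (sym (length-map windowSum ws′)) (trans (cong length sums≡) (length-map windowSum ws))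

permutePath : ∀ {K} → (Fin K → Fin K) → ℕ → List Step → List Step
permutePath π n w = decode (proj₁ (encode w) , permuteWindows π n (proj₂ (encode w)))

permutePath-inverse : ∀ {K} {π π′ : Fin K → Fin K} → (∀ i → π (π′ i) ≡ i) →
  ∀ n w → permutePath π′ n (permutePath π n w) ≡ w
permutePath-inverse {π = π} {π′} inv n w = begin
  permutePath π′ n (permutePath π n w)                      ≡⟨ cong (λ x → decode (proj₁ x , permuteWindows π′ n (proj₂ x)))
                                                                    (encode∘decode c (permuteWindows π n cs)) ⟩
  decode (c , permuteWindows π′ n (permuteWindows π n cs))  ≡⟨ cong (λ x → decode (c , x)) (permuteWindows-inverse inv n cs) ⟩
  decode (encode w)                                         ≡⟨ decode∘encode w ⟩
  w                                                         ∎
  where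
  open ≡-Reasoning
  c : ℕ
  c = proj₁ (encode w)
  cs : List ℕ
  cs = proj₂ (encode w)

permutePath-windows : ∀ {K} (π : Fin K → Fin K) ws →
  permutePath π (length ws) (blocks (flatten ws)) ≡ blocks (flatten (map (permute π) ws))
permutePath-windows π ws rewrite encode∘decode 0 (flatten ws) = cong blocks (permuteWindows-flatten π ws)

InK-permutePath : ∀ {m n} {b b′ : Fin (suc m) → ℕ} (σ : Permutation′ (suc m)) → (∀ i → b′ i ≡ b (σ ⟨$⟩ʳ i)) →
  ∀ {w} → InK m m n b w → InK m m n b′ (permutePath (σ ⟨$⟩ʳ_) n w)
InK-permutePath σ b′≡ inK with InK-windowed inK
... | ws , refl , refl = subst (InK _ _ _ _) (sym (permutePath-windows (σ ⟨$⟩ʳ_) ws))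
  (InK-windows (σ ⟨$⟩ʳ_) ws (map (permute (σ ⟨$⟩ʳ_)) ws)
    (trans (sym (map-∘ ws)) (map-cong (windowSum-permute σ) ws)) (columnSum-permute (σ ⟨$⟩ʳ_) ws) b′≡ inK)

lemma2p1 : (m n : ℕ) (a : Fin (suc m) → ℕ) → sumFin a ≡ n →
    (σ : Permutation′ (suc m)) →
    cardK m m n a ≡ cardK m m n (λ i → a (σ ⟨$⟩ʳ i))
lemma2p1 m n a _ σ =
  filter-words-length-≡ (inK? m m n a) (inK? m m n (λ i → a (σ ⟨$⟩ʳ i)))
    (permutePath (σ ⟨$⟩ʳ_) n) (permutePath (flip σ ⟨$⟩ʳ_) n)
    (permutePath-inverse (λ i → inverseʳ σ) n) (permutePath-inverse (λ i → inverseˡ σ) n)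
    (InK-permutePath σ (λ i → refl)) (InK-permutePath (flip σ) (λ i → cong a (sym (inverseʳ σ))))
    ((suc m + 1) * n) InK-length InK-length
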